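{- Let $G$ be a proper interval graph with no twin vertices, with a positive weight assigned to each edge, and let $\sigma$ be a proper interval ordering of $G$. Let $I_{\widehat{G}}$ be a maximum-weight independent set of the line-incompatibility graph $\widehat{G}$ (each node weighted by the weight of its edge). Let $x,y,z$ be vertices of $G$ with $x\prec y\prec z$ in $\sigma$. If $xz\in I_{\widehat{G}}$ then $xy\in I_{\widehat{G}}$ or $yz\in I_{\widehat{G}}$.
   Context: All graphs are finite, simple and undirected. A vertex ordering $\sigma=\langle v_1,\dots,v_n\rangle$ is a proper interval ordering if for all vertices $a\prec b\prec c$ in $\sigma$, $\{a,c\}\in E(G)$ implies $\{a,b\},\{b,c\}\in E(G)$; a graph is a proper interval graph iff it has a proper interval ordering. Two adjacent vertices $u,v$ are twins if $N[u]=N[v]$ (closed neighbourhoods). The line-incompatibility graph $\widehat{G}$ has a node $uv$ for each edge $\{u,v\}$ of $G$, two nodes being adjacent iff the corresponding edges share an endpoint and their three endpoints induce a $P_3$ in $G$.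
   Formalization: The edge weights are positive rationals. -}

module Defs where

open import Data.Nat using (ℕ)
open import Data.Fin using (Fin; toℕ)
open import Data.Bool using (Bool; true; false; if_then_else_)
open import Data.List using (List; foldr; allFin; concatMap)
open import Data.Product using (_×_; _,_)
open import Data.Sum using (_⊎_)
open import Data.Empty using (⊥)
open import Relation.Nullary using (¬_; does)
open import Relation.Binary.PropositionalEquality using (_≡_; _≢_)
open import Function.Bundles using (_⇔_)
open import Function.Definitions using (Injective)
import Data.Nat as ℕ
open import Data.Rational using (ℚ; 0ℚ; _+_; _<_; _≤_)

record Graph (n : ℕ) : Set where
  field
    adj   : Fin n → Fin n → Bool
    sym   : ∀ u v → adj u v ≡ adj v u
    irrefl : ∀ u → adj u u ≡ false

module _ {n : ℕ} (G : Graph n) where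
  open Graph G

  Adj : Fin n → Fin n → Set
  Adj u v = adj u v ≡ true

  InClosedNbhd : Fin n → Fin n → Set
  InClosedNbhd u w = (w ≡ u) ⊎ Adj u w

  Twins : Fin n → Fin n → Set
  Twins u v = Adj u v × (∀ w → InClosedNbhd u w ⇔ InClosedNbhd v w)

  NoTwins : Set
  NoTwins = ∀ u v → ¬ Twins u v

  -- A vertex ordering σ = ⟨v_1,…,v_n⟩ is given by the position map pos
  -- (an injective, hence bijective, map Fin n → Fin n); a ≺ b iff pos a < pos b.
  record VertexOrdering : Set where
    field
      pos   : Fin n → Fin n
      pos-inj : Injective _≡_ _≡_ pos

  _≺[_]_ : Fin n → VertexOrdering → Fin n → Set
  a ≺[ σ ] b = toℕ (VertexOrdering.pos σ a) ℕ.< toℕ (VertexOrdering.pos σ b)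

  IsProperIntervalOrdering : VertexOrdering → Set
  IsProperIntervalOrdering σ =
    ∀ a b c → a ≺[ σ ] b → b ≺[ σ ] c → Adj a c → Adj a b × Adj b c

  IsProperIntervalGraph : Set
  IsProperIntervalGraph = Data.Product.∃ IsProperIntervalOrdering

  -- A set of edges of G, i.e. a set of nodes of the line-incompatibility
  -- graph Ĝ. mem u v = mem v u encodes the unordered edge {u,v}.
  record EdgeSet : Set where
    field
      mem    : Fin n → Fin n → Bool
      mem-sym : ∀ u v → mem u v ≡ mem v u
      mem-edge : ∀ u v → mem u v ≡ true → Adj u v

  _∈E_ : (Fin n × Fin n) → EdgeSet → Set
  (u , v) ∈E S = EdgeSet.mem S u v ≡ true

  LineIncompatible : (Fin n × Fin n) → (Fin n × Fin n) → Set
  LineIncompatible (u , v) (u' , v') =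
    Data.Product.∃ λ a → Data.Product.∃ λ b → Data.Product.∃ λ c →
      ((u , v) ≡ (a , b) ⊎ (u , v) ≡ (b , a)) ×
      ((u' , v') ≡ (a , c) ⊎ (u' , v') ≡ (c , a)) ×
      Adj a b × Adj a c × b ≢ c × ¬ Adj b c

  IndependentÂ : EdgeSet → Set
  IndependentÂ S = ∀ e f → e ∈E S → f ∈E S → ¬ LineIncompatible e f

  -- Edge weights (rational; symmetric so that it is a function of the
  -- unordered edge), positive on every edge.
  record EdgeWeight : Set where
    field
      wt     : Fin n → Fin n → ℚ
      wt-sym : ∀ u v → wt u v ≡ wt v u
      wt-pos : ∀ u v → Adj u v → 0ℚ < wt u v

  -- weight of an edge set: sum over unordered pairs {u,v} (u < v) in S.
  weight : EdgeWeight → EdgeSet → ℚ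
  weight w S =
    foldr _+_ 0ℚ
      (concatMap (λ u → concatMap (λ v →
          if does (toℕ u ℕ.<? toℕ v) then
            (if EdgeSet.mem S u v then EdgeWeight.wt w u v ∷ [] else [])
          else []) (allFin n)) (allFin n))
    where open Data.List using (_∷_; [])

  IsMaxWeightIndependentÂ : EdgeWeight → EdgeSet → Set
  IsMaxWeightIndependentÂ w S =
    IndependentÂ S × (∀ S' → IndependentÂ S' → weight w S' ≤ weight w S)

-- Suppose xz ∈ I but neither xy nor yz is.  Since the weights are positive, a
-- maximum-weight independent set is maximal, so adding xy (resp. yz) to I must
-- create an induced P₃ with an edge of I.  The umbrella property rules out
-- such a P₃ at x (resp. z), because it would clash with xz; so y has edges
-- yv, yu ∈ I with v ∉ N[x] and u ∉ N[z].  The umbrella property forces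
-- u ≺ y ≺ v, and then u–y–v is an induced P₃ inside I unless uv is an edge,
-- which in turn would force u ∈ N[z] or v ∈ N[x].
module Submission where

open import Defs
open import Data.Nat using (ℕ)
import Data.Nat as ℕ
import Data.Nat.Properties as ℕ
open import Data.Fin using (Fin; toℕ; _≟_)
open import Data.Fin.Properties using (toℕ-injective)
open import Data.Bool using (true; false; _∨_; if_then_else_)
open import Data.Bool.Properties using (∨-zeroʳ; ¬-not)
import Data.Bool.Properties as Bool
open import Data.List using (List; []; _∷_; _++_; foldr; concatMap; allFin)
open import Data.List.Relation.Unary.Any using (here; there)
open import Data.List.Membership.Propositional using () renaming (_∈_ to _∈ˡ_)
open import Data.List.Membership.Propositional.Properties using (∈-allFin)
open import Data.Product using (_×_; _,_; proj₁; proj₂)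
open import Data.Sum using (_⊎_; inj₁; inj₂)
open import Data.Empty using (⊥; ⊥-elim)
open import Function using (flip; _∘_; mk⇔)
open import Level using (0ℓ)
open import Relation.Nullary using (¬_; Dec; yes; no; does; contradiction)
open import Relation.Nullary.Decidable using (_×-dec_; _⊎-dec_; dec-true; does-⇔)
open import Relation.Binary using (Rel; IsStrictTotalOrder; Trichotomous; tri<; tri≈; tri>)
import Relation.Binary.Construct.Flip.EqAndOrd as Flip
open import Relation.Binary.PropositionalEquality
open import Data.Rational using (ℚ; 0ℚ; _+_; _<_; _≤_)
import Data.Rational.Properties as ℚ

sumℚ : List ℚ → ℚ
sumℚ = foldr _+_ 0ℚ

sumℚ-++ : ∀ xs ys → sumℚ (xs ++ ys) ≡ sumℚ xs + sumℚ ys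
sumℚ-++ []       ys = sym (ℚ.+-identityˡ (sumℚ ys))
sumℚ-++ (x ∷ xs) ys = begin
  x + sumℚ (xs ++ ys)      ≡⟨ cong (x +_) (sumℚ-++ xs ys) ⟩
  x + (sumℚ xs + sumℚ ys)  ≡⟨ ℚ.+-assoc x (sumℚ xs) (sumℚ ys) ⟨
  x + sumℚ xs + sumℚ ys    ∎
  where open ≡-Reasoning

module _ {A : Set} {f g : A → List ℚ} (f≤g : ∀ a → sumℚ (f a) ≤ sumℚ (g a)) where

  sumℚ-concatMap-mono-≤ : ∀ xs → sumℚ (concatMap f xs) ≤ sumℚ (concatMap g xs)
  sumℚ-concatMap-mono-≤ []       = ℚ.≤-refl
  sumℚ-concatMap-mono-≤ (x ∷ xs)
    rewrite sumℚ-++ (f x) (concatMap f xs) | sumℚ-++ (g x) (concatMap g xs)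
    = ℚ.+-mono-≤ (f≤g x) (sumℚ-concatMap-mono-≤ xs)

  sumℚ-concatMap-mono-< : ∀ {a} xs → a ∈ˡ xs → sumℚ (f a) < sumℚ (g a) →
                          sumℚ (concatMap f xs) < sumℚ (concatMap g xs)
  sumℚ-concatMap-mono-< (x ∷ xs) a∈
    rewrite sumℚ-++ (f x) (concatMap f xs) | sumℚ-++ (g x) (concatMap g xs)
    with a∈
  ... | here refl = λ fa<ga → ℚ.+-mono-<-≤ fa<ga (sumℚ-concatMap-mono-≤ xs)
  ... | there a∈xs = ℚ.+-mono-≤-< (f≤g x) ∘ sumℚ-concatMap-mono-< xs a∈xs

∨-does⁻ : ∀ {b} {A : Set} (a? : Dec A) → b ∨ does a? ≡ true → b ≡ true ⊎ A
∨-does⁻ {true}  _       _ = inj₁ refl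
∨-does⁻ {false} (yes a) _ = inj₂ a

module _ {n : ℕ} (G : Graph n) where
  open EdgeSet

  private
    infix 4 _∈_
    _∈_ : Fin n × Fin n → EdgeSet G → Set
    _∈_ = _∈E_ G

  Adj-sym : ∀ {u v} → Adj G u v → Adj G v u
  Adj-sym {u} {v} uv = trans (Graph.sym G v u) uv

  Adj-irrefl : ∀ {u} → ¬ Adj G u u
  Adj-irrefl {u} uu with () ← trans (sym uu) (Graph.irrefl G u)

  Adj? : ∀ u v → Dec (Adj G u v)
  Adj? u v = Graph.adj G u v Bool.≟ true

  ∈E? : ∀ e S → Dec (e ∈ S)
  ∈E? (u , v) S = mem S u v Bool.≟ true

  ∈E-sym : ∀ {S u v} → (u , v) ∈ S → (v , u) ∈ S
  ∈E-sym {S} {u} {v} uv = trans (mem-sym S v u) uv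

  InducedP₃ : Fin n → Fin n → Fin n → Set
  InducedP₃ b a c = Adj G a b × Adj G a c × b ≢ c × ¬ Adj G b c

  InducedP₃-sym : ∀ {a b c} → InducedP₃ b a c → InducedP₃ c a b
  InducedP₃-sym (ab , ac , b≢c , ¬bc) = ac , ab , b≢c ∘ sym , ¬bc ∘ Adj-sym

  CompatibleAt : EdgeSet G → Fin n → Fin n → Set
  CompatibleAt S a b = ∀ c → (a , c) ∈ S → ¬ InducedP₃ b a c

  P₃-free : EdgeSet G → Set
  P₃-free S = ∀ a b → (a , b) ∈ S → CompatibleAt S a b

  independent⇒P₃-free : ∀ {S} → IndependentÂ G S → P₃-free S
  independent⇒P₃-free indep a b ab∈ c ac∈ (ab , ac , b≢c , ¬bc) =
    indep (a , b) (a , c) ab∈ ac∈ (a , b , c , inj₁ refl , inj₁ refl , ab , ac , b≢c , ¬bc)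

  P₃-free⇒independent : ∀ {S} → P₃-free S → IndependentÂ G S
  P₃-free⇒independent {S} free e f e∈ f∈ (a , b , c , e≡ , f≡ , P₃) =
    free a b (oriented e≡ e∈) c (oriented f≡ f∈) P₃
    where
    oriented : ∀ {e u v} → e ≡ (u , v) ⊎ e ≡ (v , u) → e ∈ S → (u , v) ∈ S
    oriented (inj₁ refl) = λ uv → uv
    oriented (inj₂ refl) = ∈E-sym {S}

  _≐_ : Fin n × Fin n → Fin n × Fin n → Set
  (u , v) ≐ (p , q) = (u ≡ p × v ≡ q) ⊎ (u ≡ q × v ≡ p)

  _≐?_ : ∀ e f → Dec (e ≐ f)
  (u , v) ≐? (p , q) = (u ≟ p ×-dec v ≟ q) ⊎-dec (u ≟ q ×-dec v ≟ p)

  ≐-swap : ∀ {u v p q} → (u , v) ≐ (p , q) → (v , u) ≐ (p , q)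
  ≐-swap (inj₁ (u≡p , v≡q)) = inj₂ (v≡q , u≡p)
  ≐-swap (inj₂ (u≡q , v≡p)) = inj₁ (v≡p , u≡q)

  module _ (S : EdgeSet G) {p q : Fin n} (pq : Adj G p q) where

    insert : EdgeSet G
    insert = record
      { mem      = λ u v → mem S u v ∨ does ((u , v) ≐? (p , q))
      ; mem-sym  = λ u v → cong₂ _∨_ (mem-sym S u v)
                                     (does-⇔ (mk⇔ ≐-swap ≐-swap) ((u , v) ≐? _) ((v , u) ≐? _))
      ; mem-edge = λ u v m → edge (∨-does⁻ ((u , v) ≐? (p , q)) m)
      }
      where
      edge : ∀ {u v} → (u , v) ∈ S ⊎ (u , v) ≐ (p , q) → Adj G u v
      edge {u} {v} (inj₁ uv∈) = mem-edge S u v uv∈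
      edge (inj₂ (inj₁ (refl , refl))) = pq
      edge (inj₂ (inj₂ (refl , refl))) = Adj-sym pq

    ∈-insert⁻ : ∀ {u v} → (u , v) ∈ insert → (u , v) ∈ S ⊎ (u , v) ≐ (p , q)
    ∈-insert⁻ {u} {v} = ∨-does⁻ ((u , v) ≐? (p , q))

    ∈-insert⁺ : ∀ {u v} → (u , v) ∈ S → (u , v) ∈ insert
    ∈-insert⁺ uv∈ rewrite uv∈ = refl

    ∈-insert-new : (p , q) ∈ insert
    ∈-insert-new = trans (cong (mem S p q ∨_) (dec-true ((p , q) ≐? (p , q)) (inj₁ (refl , refl))))
                         (∨-zeroʳ (mem S p q))

    insert-P₃-free : P₃-free S → CompatibleAt S p q → CompatibleAt S q p → P₃-free insert
    insert-P₃-free free p-ok q-ok a b ab∈ c ac∈ P₃@(_ , _ , b≢c , _) with ∈-insert⁻ ab∈ | ∈-insert⁻ ac∈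
    ... | inj₁ ab∈S | inj₁ ac∈S = free a b ab∈S c ac∈S P₃
    ... | inj₁ ab∈S | inj₂ (inj₁ (refl , refl)) = p-ok b ab∈S (InducedP₃-sym P₃)
    ... | inj₁ ab∈S | inj₂ (inj₂ (refl , refl)) = q-ok b ab∈S (InducedP₃-sym P₃)
    ... | inj₂ (inj₁ (refl , refl)) | inj₁ ac∈S = p-ok c ac∈S P₃
    ... | inj₂ (inj₂ (refl , refl)) | inj₁ ac∈S = q-ok c ac∈S P₃
    ... | inj₂ (inj₁ (refl , refl)) | inj₂ (inj₁ (_ , refl)) = b≢c refl
    ... | inj₂ (inj₂ (refl , refl)) | inj₂ (inj₂ (_ , refl)) = b≢c refl
    ... | inj₂ (inj₁ (refl , refl)) | inj₂ (inj₂ (p≡q , _)) = Adj-irrefl (subst (Adj G p) (sym p≡q) pq)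
    ... | inj₂ (inj₂ (refl , refl)) | inj₂ (inj₁ (q≡p , _)) = Adj-irrefl (subst (Adj G p) q≡p pq)

  module _ (w : EdgeWeight G) where
    open EdgeWeight w

    _⊆E_ : EdgeSet G → EdgeSet G → Set
    S ⊆E S' = ∀ {u v} → (u , v) ∈ S → (u , v) ∈ S'

    -- weight G w S unfolds to the sum of the concatenated weightTerm S u v over all u, v
    weightTerm : EdgeSet G → Fin n → Fin n → List ℚ
    weightTerm S u v =
      if does (toℕ u ℕ.<? toℕ v) then (if mem S u v then wt u v ∷ [] else []) else []

    sumℚ-wt-pos : ∀ {u v} → Adj G u v → 0ℚ < sumℚ (wt u v ∷ [])
    sumℚ-wt-pos {u} {v} uv rewrite ℚ.+-identityʳ (wt u v) = wt-pos u v uv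

    module _ {S S' : EdgeSet G} (S⊆S' : S ⊆E S') where

      weightTerm-mono-≤ : ∀ u v → sumℚ (weightTerm S u v) ≤ sumℚ (weightTerm S' u v)
      weightTerm-mono-≤ u v with does (toℕ u ℕ.<? toℕ v)
      ... | false = ℚ.≤-refl
      ... | true with mem S u v in uv∈S | mem S' u v in uv∈S'
      ... | false | false = ℚ.≤-refl
      ... | false | true  = ℚ.<⇒≤ (sumℚ-wt-pos (mem-edge S' u v uv∈S'))
      ... | true  | true  = ℚ.≤-refl
      ... | true  | false with () ← trans (sym (S⊆S' uv∈S)) uv∈S'

      weightTerm-mono-< : ∀ {p q} → toℕ p ℕ.< toℕ q → ¬ (p , q) ∈ S → (p , q) ∈ S' →
                          sumℚ (weightTerm S p q) < sumℚ (weightTerm S' p q)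
      weightTerm-mono-< {p} {q} p<q pq∉S pq∈S'
        rewrite dec-true (toℕ p ℕ.<? toℕ q) p<q | ¬-not pq∉S | pq∈S'
        = sumℚ-wt-pos (mem-edge S' p q pq∈S')

      weight-mono-<-ordered : ∀ {p q} → toℕ p ℕ.< toℕ q → ¬ (p , q) ∈ S → (p , q) ∈ S' →
                              weight G w S < weight G w S'
      weight-mono-<-ordered {p} {q} p<q pq∉S pq∈S' =
        sumℚ-concatMap-mono-< (λ u → sumℚ-concatMap-mono-≤ (weightTerm-mono-≤ u) (allFin n))
          (allFin n) (∈-allFin p)
          (sumℚ-concatMap-mono-< (weightTerm-mono-≤ p)
             (allFin n) (∈-allFin q) (weightTerm-mono-< p<q pq∉S pq∈S'))

      weight-mono-< : ∀ {p q} → Adj G p q → ¬ (p , q) ∈ S → (p , q) ∈ S' →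
                      weight G w S < weight G w S'
      weight-mono-< {p} {q} pq pq∉S pq∈S' with ℕ.<-cmp (toℕ p) (toℕ q)
      ... | tri< p<q _ _ = weight-mono-<-ordered p<q pq∉S pq∈S'
      ... | tri≈ _ p≡q _ = contradiction (subst (Adj G p) (sym (toℕ-injective p≡q)) pq) Adj-irrefl
      ... | tri> _ _ q<p = weight-mono-<-ordered q<p (pq∉S ∘ ∈E-sym {S}) (∈E-sym {S'} pq∈S')

    max-weight⇒maximal : ∀ {I p q} → IsMaxWeightIndependentÂ G w I →
                         Adj G p q → ¬ (p , q) ∈ I →
                         CompatibleAt I p q → CompatibleAt I q p → ⊥
    max-weight⇒maximal {I} (indep , maximum) pq pq∉I p-ok q-ok = ℚ.<-irrefl refl (ℚ.<-≤-trans
      (weight-mono-< {I} {insert I pq} (∈-insert⁺ I pq) pq pq∉I (∈-insert-new I pq))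
      (maximum (insert I pq)
        (P₃-free⇒independent {insert I pq}
          (insert-P₃-free I pq (independent⇒P₃-free {I} indep) p-ok q-ok))))

  UmbrellaProperty : Rel (Fin n) 0ℓ → Set
  UmbrellaProperty _≺_ = ∀ a b c → a ≺ b → b ≺ c → Adj G a c → Adj G a b × Adj G b c

  UmbrellaProperty-flip : ∀ {_≺_} → UmbrellaProperty _≺_ → UmbrellaProperty (flip _≺_)
  UmbrellaProperty-flip umbrella a b c b≺a c≺b ac =
    let cb , ba = umbrella c b a c≺b b≺a (Adj-sym ac) in Adj-sym ba , Adj-sym cb

  position-isStrictTotalOrder : (σ : VertexOrdering G) →
                                IsStrictTotalOrder _≡_ (λ a b → _≺[_]_ G a σ b)
  position-isStrictTotalOrder σ = record
    { isStrictPartialOrder = record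
      { isEquivalence = isEquivalence
      ; irrefl        = λ { refl → ℕ.<-irrefl refl }
      ; trans         = ℕ.<-trans
      ; <-resp-≈      = (λ { refl a≺b → a≺b }) , (λ { refl a≺b → a≺b })
      }
    ; compare = compare
    }
    where
    open VertexOrdering σ
    compare : Trichotomous _≡_ (λ a b → _≺[_]_ G a σ b)
    compare a b with ℕ.<-cmp (toℕ (pos a)) (toℕ (pos b))
    ... | tri< a≺b a≉b b⊀a = tri< a≺b (a≉b ∘ cong (toℕ ∘ pos)) b⊀a
    ... | tri≈ a⊀b a≈b b⊀a = tri≈ a⊀b (pos-inj (toℕ-injective a≈b)) b⊀a
    ... | tri> a⊀b a≉b b≺a = tri> a⊀b (a≉b ∘ cong (toℕ ∘ pos)) b≺a

  module UmbrellaOrder {_≺_ : Rel (Fin n) 0ℓ} (sto : IsStrictTotalOrder _≡_ _≺_)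
                       (umbrella : UmbrellaProperty _≺_) where
    open IsStrictTotalOrder sto using (compare)

    umbrellaˡ : ∀ {a b c} → a ≺ b → b ≺ c → Adj G a c → Adj G a b
    umbrellaˡ a≺b b≺c ac = proj₁ (umbrella _ _ _ a≺b b≺c ac)

    umbrellaʳ : ∀ {a b c} → a ≺ b → b ≺ c → Adj G a c → Adj G b c
    umbrellaʳ a≺b b≺c ac = proj₂ (umbrella _ _ _ a≺b b≺c ac)

    far-neighbour : ∀ {x y v} → x ≺ y → Adj G x y → Adj G y v → x ≢ v → ¬ Adj G x v → y ≺ v
    far-neighbour {x} {y} {v} x≺y xy yv x≢v ¬xv with compare v x
    ... | tri< v≺x _ _ = contradiction (Adj-sym (umbrellaˡ v≺x x≺y (Adj-sym yv))) ¬xv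
    ... | tri≈ _ v≡x _ = contradiction (sym v≡x) x≢v
    ... | tri> _ _ x≺v with compare v y
    ...   | tri< v≺y _ _ = contradiction (umbrellaˡ x≺v v≺y xy) ¬xv
    ...   | tri≈ _ refl _ = contradiction yv Adj-irrefl
    ...   | tri> _ _ y≺v = y≺v

    -- An induced P₃ y–x–c with xc ∈ I would give c ∉ N[z] (so z–x–c is a P₃ in I)
    -- or c ∈ N(x) ∩ N(z), which the umbrella property puts into N(y).
    span-compatible : ∀ {I x y z} → P₃-free I → x ≺ y → y ≺ z → (x , z) ∈ I →
                      CompatibleAt I x y
    span-compatible {I} {x} {y} {z} free x≺y y≺z xz∈ c xc∈ (xy , xc , y≢c , ¬yc)
      with c ≟ z
    ... | yes refl = ¬yc (umbrellaʳ x≺y y≺z xc)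
    ... | no c≢z with Adj? z c
    ...   | no ¬zc = free x z xz∈ c xc∈ (mem-edge I x z xz∈ , xc , c≢z ∘ sym , ¬zc)
    ...   | yes zc with compare c y
    ...     | tri< c≺y _ _ = ¬yc (Adj-sym (umbrellaˡ c≺y y≺z (Adj-sym zc)))
    ...     | tri≈ _ c≡y _ = y≢c (sym c≡y)
    ...     | tri> _ _ y≺c = ¬yc (umbrellaʳ x≺y y≺c xc)

  module UmbrellaOrderBothWays {_≺_ : Rel (Fin n) 0ℓ} (sto : IsStrictTotalOrder _≡_ _≺_)
                               (umbrella : UmbrellaProperty _≺_) where
    open IsStrictTotalOrder sto using (compare; asym) renaming (trans to ≺-trans)
    open UmbrellaOrder sto umbrella public
    private
      module Reversed = UmbrellaOrder (Flip.isStrictTotalOrder sto) (UmbrellaProperty-flip umbrella)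

    reversed-span-compatible : ∀ {I x y z} → P₃-free I → x ≺ y → y ≺ z → (x , z) ∈ I →
                               CompatibleAt I z y
    reversed-span-compatible {I} free x≺y y≺z xz∈ =
      Reversed.span-compatible {I} free y≺z x≺y (∈E-sym {I} xz∈)

    middle-compatible : ∀ {I x y z} → P₃-free I → x ≺ y → y ≺ z → Adj G x z →
                        ¬ (¬ CompatibleAt I y x × ¬ CompatibleAt I y z)
    middle-compatible {I} {x} {y} {z} free x≺y y≺z xz (¬yx-ok , ¬yz-ok) =
      ¬yx-ok λ v yv∈ (yx , yv , x≢v , ¬xv) →
      ¬yz-ok λ u yu∈ (yz , yu , z≢u , ¬zu) →
      let y≺v = far-neighbour x≺y (Adj-sym yx) yv x≢v ¬xv
          u≺y = Reversed.far-neighbour y≺z (Adj-sym yz) yu z≢u ¬zu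
      in conflict yv∈ yu∈ yv yu ¬xv ¬zu y≺v u≺y
      where
      conflict : ∀ {v u} → (y , v) ∈ I → (y , u) ∈ I → Adj G y v → Adj G y u →
                 ¬ Adj G x v → ¬ Adj G z u → y ≺ v → u ≺ y → ⊥
      conflict {v} {u} yv∈ yu∈ yv yu ¬xv ¬zu y≺v u≺y with Adj? u v
      ... | no ¬uv = free y u yu∈ v yv∈ (yu , yv , (λ { refl → asym u≺y y≺v }) , ¬uv)
      ... | yes uv with compare u x
      ...   | tri> _ _ x≺u = ¬zu (Adj-sym (umbrellaʳ x≺u (≺-trans u≺y y≺z) xz))
      ...   | tri≈ _ refl _ = ¬zu (Adj-sym xz)
      ...   | tri< u≺x _ _ with compare v z
      ...     | tri< v≺z _ _ = ¬xv (umbrellaˡ (≺-trans x≺y y≺v) v≺z xz)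
      ...     | tri≈ _ refl _ = ¬xv xz
      ...     | tri> _ _ z≺v =
                  ¬zu (Adj-sym (umbrellaˡ (≺-trans u≺x (≺-trans x≺y y≺z)) z≺v uv))

lemma7 : (n : ℕ) (G : Graph n) → IsProperIntervalGraph G → NoTwins G →
    (w : EdgeWeight G) (σ : VertexOrdering G) → IsProperIntervalOrdering G σ →
    (I : EdgeSet G) → IsMaxWeightIndependentÂ G w I →
    (x y z : Fin n) → _≺[_]_ G x σ y → _≺[_]_ G y σ z →
    _∈E_ G (x , z) I → _∈E_ G (x , y) I ⊎ _∈E_ G (y , z) I
lemma7 _ G _ _ w σ pio I maxI x y z x≺y y≺z xz∈ with ∈E? G (x , y) I | ∈E? G (y , z) I
... | yes xy∈ | _       = inj₁ xy∈
... | no _    | yes yz∈ = inj₂ yz∈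
... | no xy∉  | no yz∉  = ⊥-elim (middle-compatible {I} free x≺y y≺z xz (¬y-x-ok , ¬y-z-ok))
  where
  open UmbrellaOrderBothWays G (position-isStrictTotalOrder G σ) pio

  free : P₃-free G I
  free = independent⇒P₃-free G {I} (proj₁ maxI)

  xz : Adj G x z
  xz = EdgeSet.mem-edge I x z xz∈

  ¬y-x-ok : ¬ CompatibleAt G I y x
  ¬y-x-ok = max-weight⇒maximal G w {I} maxI (umbrellaˡ x≺y y≺z xz) xy∉
              (span-compatible {I} free x≺y y≺z xz∈)

  ¬y-z-ok : ¬ CompatibleAt G I y z
  ¬y-z-ok y-ok = max-weight⇒maximal G w {I} maxI (umbrellaʳ x≺y y≺z xz) yz∉
                   y-ok (reversed-span-compatible {I} free x≺y y≺z xz∈)
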